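{- Let $n\geq 1$. Let $\mathcal{D}_n$ be the set of generalized compositions $v^w$ of $n$ with $\gcd(v^w)=1$, and let $K_n^{\geq 0}$ be the set of all irreducible square matrices (of any size $k\geq 1$) with entries in $\mathbb{Z}_{\geq 0}$ satisfying $A^2=nA$. Then the map $\varphi:\mathcal{D}_n\to K_n^{\geq 0}$, $\varphi(v^w)=vw^t$, is a (well-defined) bijection.
   Context: A generalized composition of $n$ is a word $v^w = v_1^{w_1}v_2^{w_2}\cdots v_k^{w_k}$ (for some $k\geq 1$), i.e. an ordered pair of vectors $v=(v_1,\dots,v_k), w=(w_1,\dots,w_k)\in\mathbb{Z}_{>0}^k$ with $\sum_{i=1}^k v_iw_i=n$. Its greatest common divisor is $\gcd(v^w)=\gcd(v_1,\dots,v_k)$ (equal to $v_1$ if $k=1$). Here $v,w$ are regarded as column vectors, so $vw^t$ is a $k\times k$ matrix. A non-negative $k\times k$ matrix $A$ is irreducible if for every pair $i,j$ there exists $m\geq 1$ with $(A^m)_{i,j}>0$. -}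

module Defs where

open import Data.Nat using (ℕ; suc; _*_; _<_; _≤_)
open import Data.Nat.GCD using (gcd)
open import Data.Fin using (Fin)
open import Data.Vec using (Vec; lookup; tabulate; map; zipWith; sum; foldr)
open import Data.Vec.Relation.Unary.All using (All)
open import Data.Product using (∃; _×_)
open import Relation.Binary.PropositionalEquality using (_≡_)

Matrix : ℕ → Set
Matrix k = Vec (Vec ℕ k) k

entry : ∀ {k} → Matrix k → Fin k → Fin k → ℕ
entry A i j = lookup (lookup A i) j

_⊗_ : ∀ {k} → Matrix k → Matrix k → Matrix k
A ⊗ B = tabulate λ i → tabulate λ j → sum (tabulate λ l → entry A i l * entry B l j)

_·_ : ∀ {k} → ℕ → Matrix k → Matrix k
c · A = map (map (c *_)) A

-- powerˢ A m = A^(m+1)   (positive powers only)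
powerˢ : ∀ {k} → Matrix k → ℕ → Matrix k
powerˢ A 0 = A
powerˢ A (suc m) = A ⊗ powerˢ A m

Irreducible : ∀ {k} → Matrix k → Set
Irreducible {k} A = ∀ (i j : Fin k) → ∃ λ m → 0 < entry (powerˢ A m) i j

outer : ∀ {k} → Vec ℕ k → Vec ℕ k → Matrix k
outer v w = tabulate λ i → tabulate λ j → lookup v i * lookup w j

-- gcd of the entries of a vector (gcd of a single entry x is x)
gcdVec : ∀ {k} → Vec ℕ k → ℕ
gcdVec = foldr _ gcd 0

-- v^w is a generalized composition of n (of length k ≥ 1 via indexing by suc k)
IsGenComp : ℕ → ∀ {k} → Vec ℕ k → Vec ℕ k → Set
IsGenComp n v w = All (0 <_) v × All (0 <_) w × sum (zipWith _*_ v w) ≡ n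

InD : ℕ → ∀ {k} → Vec ℕ k → Vec ℕ k → Set
InD n v w = IsGenComp n v w × gcdVec v ≡ 1

InK : ℕ → ∀ {k} → Matrix k → Set
InK n A = Irreducible A × A ⊗ A ≡ n · A

-- Squaring an irreducible A with A² = nA gives A^(m+1) = n^m A, so all entries of A are
-- positive.  Every column of A is then a positive eigenvector of A for the eigenvalue n, and
-- two such eigenvectors are proportional: at an index i where x_i / y_i is minimal, the
-- termwise inequalities between Σ_l a_il x_i y_l and Σ_l a_il x_l y_i are equalities because
-- both sums equal n x_i y_i.  So A has rank one; dividing its first column by its gcd gives a
-- primitive v, the column gcds give w, and A = v wᵗ.  Conversely (v wᵗ)² = (w·v) v wᵗ, and
-- v wᵗ determines w (the gcd of its j-th column is w_j · gcd v = w_j) and then v.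

module Submission where

open import Defs
open import Data.Nat using (ℕ; zero; suc; _+_; _*_; _^_; _≤_; _<_; z<s; >-nonZero; >-nonZero⁻¹)
open import Data.Nat.Properties
open import Data.Nat.Divisibility using (_∣_; ∣-trans)
open import Data.Nat.GCD using (gcd; gcd[m,n]∣m; gcd[m,n]∣n; c*gcd[m,n]≡gcd[cm,cn])
open import Data.Nat.Tactic.RingSolver using (solve-∀)
open import Data.Fin using (Fin; zero; suc)
open import Data.Vec using (Vec; []; _∷_; lookup; tabulate; zipWith; sum)
open import Data.Vec.Properties using (lookup∘tabulate; tabulate∘lookup; tabulate-cong; lookup-map)
open import Data.Vec.Relation.Unary.All using (All)
open import Data.Vec.Relation.Unary.All.Properties using (lookup⁺; tabulate⁺)
open import Data.Product using (∃; ∃₂; _×_; _,_)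
open import Data.Sum using (inj₁; inj₂; [_,_]′)
open import Function using (_∘_; id)
open import Relation.Binary.Core using (Rel)
open import Relation.Binary.Definitions using (Total; Transitive)
open import Relation.Binary.PropositionalEquality

open import Algebra.Properties.CommutativeSemigroup *-commutativeSemigroup
  using (x∙yz≈y∙xz; x∙yz≈z∙yx; x∙yz≈yx∙z; x∙yz≈z∙xy; xy∙z≈y∙xz)

private
  variable
    k n : ℕ

*-cancelˡ-≡-pos : ∀ {o} m n → 0 < o → o * m ≡ o * n → m ≡ n
*-cancelˡ-≡-pos {o} m n o>0 = *-cancelˡ-≡ m n o {{>-nonZero o>0}}

*-cancelʳ-≡-pos : ∀ {o} m n → 0 < o → m * o ≡ n * o → m ≡ n
*-cancelʳ-≡-pos {o} m n o>0 = *-cancelʳ-≡ m n o {{>-nonZero o>0}}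

m*n>0 : ∀ {m n} → 0 < m → 0 < n → 0 < m * n
m*n>0 {suc m} {suc n} _ _ = z<s

m*n>0⇒m>0 : ∀ m n → 0 < m * n → 0 < m
m*n>0⇒m>0 m n m*n>0 = >-nonZero⁻¹ m {{m*n≢0⇒m≢0 m {{>-nonZero m*n>0}}}}

m*n>0⇒n>0 : ∀ m n → 0 < m * n → 0 < n
m*n>0⇒n>0 m n m*n>0 = >-nonZero⁻¹ n {{m*n≢0⇒n≢0 m {{>-nonZero m*n>0}}}}

cross-≤-trans : ∀ {a} {I : Set a} (x y : I → ℕ) {i j l} → 0 < y j →
  x i * y j ≤ x j * y i → x j * y l ≤ x l * y j → x i * y l ≤ x l * y i
cross-≤-trans x y {i} {j} {l} yj>0 hij hjl = *-cancelˡ-≤ (y j) {{>-nonZero yj>0}} (begin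
  y j * (x i * y l) ≡⟨ x∙yz≈yx∙z (y j) (x i) (y l) ⟩
  (x i * y j) * y l ≤⟨ *-monoˡ-≤ (y l) hij ⟩
  (x j * y i) * y l ≡⟨ xy∙z≈y∙xz (x j) (y i) (y l) ⟩
  y i * (x j * y l) ≤⟨ *-monoʳ-≤ (y i) hjl ⟩
  y i * (x l * y j) ≡⟨ x∙yz≈z∙yx (y i) (x l) (y j) ⟩
  y j * (x l * y i) ∎)
  where open ≤-Reasoning

cross-≡-trans : ∀ {a} {I : Set a} (x y : I → ℕ) {i j l} → 0 < y j →
  x i * y j ≡ x j * y i → x j * y l ≡ x l * y j → x i * y l ≡ x l * y i
cross-≡-trans x y yj>0 hij hjl = ≤-antisym
  (cross-≤-trans x y yj>0 (≤-reflexive hij) (≤-reflexive hjl))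
  (cross-≤-trans x y yj>0 (≤-reflexive (sym hjl)) (≤-reflexive (sym hij)))

finite-minimum : ∀ {ℓ} (R : Rel (Fin (suc k)) ℓ) → Total R → Transitive R → ∃ λ i → ∀ j → R i j
finite-minimum {zero} R total trans = zero , λ { zero → [ id , id ]′ (total zero zero) }
finite-minimum {suc k} R total trans
  with finite-minimum (λ i j → R (suc i) (suc j)) (λ i j → total (suc i) (suc j)) trans
... | m , m-min with total zero (suc m)
...   | inj₁ 0≤m = zero , λ { zero → [ id , id ]′ (total zero zero) ; (suc j) → trans 0≤m (m-min j) }
...   | inj₂ m≤0 = suc m , λ { zero → m≤0 ; (suc j) → m-min j }

∑ : (Fin k → ℕ) → ℕ
∑ f = sum (tabulate f)

∑-cong : {f g : Fin k → ℕ} → f ≗ g → ∑ f ≡ ∑ g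
∑-cong f≗g = cong sum (tabulate-cong f≗g)

*-distribˡ-∑ : ∀ c (f : Fin k → ℕ) → c * ∑ f ≡ ∑ (λ l → c * f l)
*-distribˡ-∑ {zero} c f = *-zeroʳ c
*-distribˡ-∑ {suc k} c f =
  trans (*-distribˡ-+ c (f zero) (∑ (f ∘ suc))) (cong (c * f zero +_) (*-distribˡ-∑ c (f ∘ suc)))

∑-mono-≤ : {f g : Fin k → ℕ} → (∀ l → f l ≤ g l) → ∑ f ≤ ∑ g
∑-mono-≤ {zero} f≤g = ≤-refl
∑-mono-≤ {suc k} f≤g = +-mono-≤ (f≤g zero) (∑-mono-≤ (f≤g ∘ suc))

∑-mono-< : {f g : Fin k → ℕ} → (∀ l → f l ≤ g l) → ∀ l → f l < g l → ∑ f < ∑ g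
∑-mono-< f≤g zero fl<gl = +-mono-<-≤ fl<gl (∑-mono-≤ (f≤g ∘ suc))
∑-mono-< f≤g (suc l) fl<gl = +-mono-≤-< (f≤g zero) (∑-mono-< (f≤g ∘ suc) l fl<gl)

∑-mono-≤-≡⇒≗ : {f g : Fin k → ℕ} → (∀ l → f l ≤ g l) → ∑ f ≡ ∑ g → f ≗ g
∑-mono-≤-≡⇒≗ f≤g ∑f≡∑g l =
  ≤-antisym (f≤g l) (≮⇒≥ λ fl<gl → <-irrefl ∑f≡∑g (∑-mono-< f≤g l fl<gl))

sum-zipWith-* : (v w : Vec ℕ k) → sum (zipWith _*_ v w) ≡ ∑ (λ l → lookup v l * lookup w l)
sum-zipWith-* [] [] = refl
sum-zipWith-* (x ∷ v) (y ∷ w) = cong (x * y +_) (sum-zipWith-* v w)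

gcdVec-*ˡ : ∀ c (f : Fin k → ℕ) → gcdVec (tabulate λ i → c * f i) ≡ c * gcdVec (tabulate f)
gcdVec-*ˡ {zero} c f = sym (*-zeroʳ c)
gcdVec-*ˡ {suc k} c f = trans (cong (gcd (c * f zero)) (gcdVec-*ˡ c (f ∘ suc)))
  (sym (c*gcd[m,n]≡gcd[cm,cn] c (f zero) (gcdVec (tabulate (f ∘ suc)))))

gcdVec-∣ : ∀ (f : Fin k → ℕ) i → gcdVec (tabulate f) ∣ f i
gcdVec-∣ f zero = gcd[m,n]∣m (f zero) _
gcdVec-∣ f (suc i) = ∣-trans (gcd[m,n]∣n (f zero) _) (gcdVec-∣ (f ∘ suc) i)

lookup-extensionality : ∀ {a} {X : Set a} (u v : Vec X k) → lookup u ≗ lookup v → u ≡ v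
lookup-extensionality u v u≗v =
  trans (sym (tabulate∘lookup u)) (trans (tabulate-cong u≗v) (tabulate∘lookup v))

entry-extensionality : (A B : Matrix k) → (∀ i j → entry A i j ≡ entry B i j) → A ≡ B
entry-extensionality A B A≗B =
  lookup-extensionality A B λ i → lookup-extensionality (lookup A i) (lookup B i) (A≗B i)

entry-tabulate : (f : Fin k → Fin k → ℕ) → ∀ i j → entry (tabulate λ i → tabulate (f i)) i j ≡ f i j
entry-tabulate f i j = trans (cong (λ r → lookup r j) (lookup∘tabulate _ i)) (lookup∘tabulate (f i) j)

entry-⊗ : (A B : Matrix k) → ∀ i j → entry (A ⊗ B) i j ≡ ∑ (λ l → entry A i l * entry B l j)
entry-⊗ A B = entry-tabulate λ i j → ∑ (λ l → entry A i l * entry B l j)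

entry-· : ∀ c (A : Matrix k) i j → entry (c · A) i j ≡ c * entry A i j
entry-· c A i j = trans (cong (λ r → lookup r j) (lookup-map i _ A)) (lookup-map j _ (lookup A i))

entry-outer : (v w : Vec ℕ k) → ∀ i j → entry (outer v w) i j ≡ lookup v i * lookup w j
entry-outer v w = entry-tabulate λ i j → lookup v i * lookup w j

·-cancelʳ : ∀ {c d} (A : Matrix k) {i j} → 0 < entry A i j → c · A ≡ d · A → c ≡ d
·-cancelʳ {c = c} {d} A {i} {j} Aij>0 cA≡dA = *-cancelʳ-≡-pos c d Aij>0
  (trans (sym (entry-· c A i j)) (trans (cong (λ M → entry M i j) cA≡dA) (entry-· d A i j)))

outer-⊗-outer : (v w : Vec ℕ k) → outer v w ⊗ outer v w ≡ sum (zipWith _*_ v w) · outer v w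
outer-⊗-outer v w = entry-extensionality _ _ λ i j → begin
  entry (outer v w ⊗ outer v w) i j
    ≡⟨ entry-⊗ (outer v w) (outer v w) i j ⟩
  ∑ (λ l → entry (outer v w) i l * entry (outer v w) l j)
    ≡⟨ ∑-cong (λ l → cong₂ _*_ (entry-outer v w i l) (entry-outer v w l j)) ⟩
  ∑ (λ l → (v′ i * w′ l) * (v′ l * w′ j))
    ≡⟨ ∑-cong (λ l → regroup (v′ i) (w′ l) (v′ l) (w′ j)) ⟩
  ∑ (λ l → (v′ i * w′ j) * (v′ l * w′ l))
    ≡⟨ *-distribˡ-∑ (v′ i * w′ j) (λ l → v′ l * w′ l) ⟨
  (v′ i * w′ j) * ∑ (λ l → v′ l * w′ l)
    ≡⟨ *-comm (v′ i * w′ j) _ ⟩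
  ∑ (λ l → v′ l * w′ l) * (v′ i * w′ j)
    ≡⟨ cong₂ _*_ (sum-zipWith-* v w) (entry-outer v w i j) ⟨
  sum (zipWith _*_ v w) * entry (outer v w) i j
    ≡⟨ entry-· (sum (zipWith _*_ v w)) (outer v w) i j ⟨
  entry (sum (zipWith _*_ v w) · outer v w) i j ∎
  where
  open ≡-Reasoning
  v′ w′ : Fin _ → ℕ
  v′ = lookup v
  w′ = lookup w
  regroup : ∀ a b c d → (a * b) * (c * d) ≡ (a * d) * (c * b)
  regroup = solve-∀

entry-powerˢ : ∀ n {A : Matrix k} → A ⊗ A ≡ n · A → ∀ m i j → entry (powerˢ A m) i j ≡ n ^ m * entry A i j
entry-powerˢ n {A} A²≡nA zero i j = sym (*-identityˡ _)
entry-powerˢ n {A} A²≡nA (suc m) i j = begin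
  entry (A ⊗ powerˢ A m) i j
    ≡⟨ entry-⊗ A (powerˢ A m) i j ⟩
  ∑ (λ l → a i l * entry (powerˢ A m) l j)
    ≡⟨ ∑-cong (λ l → cong (a i l *_) (entry-powerˢ n A²≡nA m l j)) ⟩
  ∑ (λ l → a i l * (n ^ m * a l j))
    ≡⟨ ∑-cong (λ l → x∙yz≈y∙xz (a i l) (n ^ m) (a l j)) ⟩
  ∑ (λ l → n ^ m * (a i l * a l j))
    ≡⟨ *-distribˡ-∑ (n ^ m) (λ l → a i l * a l j) ⟨
  n ^ m * ∑ (λ l → a i l * a l j)
    ≡⟨ cong (n ^ m *_) (sym (entry-⊗ A A i j)) ⟩
  n ^ m * entry (A ⊗ A) i j
    ≡⟨ cong (λ M → n ^ m * entry M i j) A²≡nA ⟩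
  n ^ m * entry (n · A) i j
    ≡⟨ cong (n ^ m *_) (entry-· n A i j) ⟩
  n ^ m * (n * a i j)
    ≡⟨ x∙yz≈yx∙z (n ^ m) n (a i j) ⟩
  n * n ^ m * a i j ∎
  where
  open ≡-Reasoning
  a = entry A

irreducible⇒positive : ∀ n {A : Matrix k} → A ⊗ A ≡ n · A → Irreducible A → ∀ i j → 0 < entry A i j
irreducible⇒positive n A²≡nA irreducible i j with irreducible i j
... | m , Aᵐ⁺¹ij>0 = m*n>0⇒n>0 (n ^ m) _ (subst (0 <_) (entry-powerˢ n A²≡nA m i j) Aᵐ⁺¹ij>0)

IsEigenvector : (Fin k → Fin k → ℕ) → ℕ → (Fin k → ℕ) → Set
IsEigenvector a ρ x = ∀ i → ∑ (λ l → a i l * x l) ≡ ρ * x i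

columns-eigenvectors : ∀ n {A : Matrix k} → A ⊗ A ≡ n · A → ∀ j → IsEigenvector (entry A) n (λ i → entry A i j)
columns-eigenvectors n {A} A²≡nA j i =
  trans (sym (entry-⊗ A A i j)) (trans (cong (λ M → entry M i j) A²≡nA) (entry-· n A i j))

positive-eigenvectors-proportional : (a : Fin (suc k) → Fin (suc k) → ℕ) (ρ : ℕ) (x y : Fin (suc k) → ℕ) →
  (∀ i l → 0 < a i l) → (∀ l → 0 < y l) → IsEigenvector a ρ x → IsEigenvector a ρ y →
  ∀ l m → x l * y m ≡ x m * y l
positive-eigenvectors-proportional a ρ x y a>0 y>0 x-eigen y-eigen l m
  with finite-minimum (λ i l → x i * y l ≤ x l * y i) (λ i l → ≤-total _ _) (cross-≤-trans x y (y>0 _))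
... | i , i-minimal = cross-≡-trans x y (y>0 i) (sym (tight l)) (tight m)
  where
  open ≡-Reasoning
  sums-equal : ∑ (λ l → a i l * (x i * y l)) ≡ ∑ (λ l → a i l * (x l * y i))
  sums-equal = begin
    ∑ (λ l → a i l * (x i * y l)) ≡⟨ ∑-cong (λ l → x∙yz≈y∙xz (a i l) (x i) (y l)) ⟩
    ∑ (λ l → x i * (a i l * y l)) ≡⟨ *-distribˡ-∑ (x i) (λ l → a i l * y l) ⟨
    x i * ∑ (λ l → a i l * y l)   ≡⟨ cong (x i *_) (y-eigen i) ⟩
    x i * (ρ * y i)               ≡⟨ x∙yz≈z∙yx (x i) ρ (y i) ⟩
    y i * (ρ * x i)               ≡⟨ cong (y i *_) (x-eigen i) ⟨
    y i * ∑ (λ l → a i l * x l)   ≡⟨ *-distribˡ-∑ (y i) (λ l → a i l * x l) ⟩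
    ∑ (λ l → y i * (a i l * x l)) ≡⟨ ∑-cong (λ l → x∙yz≈z∙xy (a i l) (x l) (y i)) ⟨
    ∑ (λ l → a i l * (x l * y i)) ∎
  tight : ∀ l → x i * y l ≡ x l * y i
  tight l = *-cancelˡ-≡-pos _ _ (a>0 i l)
    (∑-mono-≤-≡⇒≗ (λ l → *-monoʳ-≤ (a i l) (i-minimal l)) sums-equal l)

gcdVec-column-outer : (v : Vec ℕ k) → gcdVec v ≡ 1 → ∀ (w : Vec ℕ k) j →
  gcdVec (tabulate λ i → lookup v i * lookup w j) ≡ lookup w j
gcdVec-column-outer v gcd≡1 w j = begin
  gcdVec (tabulate λ i → lookup v i * lookup w j) ≡⟨ cong gcdVec (tabulate-cong λ i → *-comm (lookup v i) _) ⟩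
  gcdVec (tabulate λ i → lookup w j * lookup v i) ≡⟨ gcdVec-*ˡ (lookup w j) (lookup v) ⟩
  lookup w j * gcdVec (tabulate (lookup v))       ≡⟨ cong (λ u → lookup w j * gcdVec u) (tabulate∘lookup v) ⟩
  lookup w j * gcdVec v                           ≡⟨ cong (lookup w j *_) gcd≡1 ⟩
  lookup w j * 1                                  ≡⟨ *-identityʳ _ ⟩
  lookup w j                                      ∎
  where open ≡-Reasoning

outer-injective : {v w v′ w′ : Vec ℕ (suc k)} → gcdVec v ≡ 1 → gcdVec v′ ≡ 1 → 0 < lookup w zero →
  outer v w ≡ outer v′ w′ → v ≡ v′ × w ≡ w′
outer-injective {v = v} {w} {v′} {w′} gcd≡1 gcd′≡1 w₀>0 vwᵗ≡v′w′ᵗ = v≡v′ , w≡w′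
  where
  same-entries : ∀ i j → lookup v i * lookup w j ≡ lookup v′ i * lookup w′ j
  same-entries i j = trans (sym (entry-outer v w i j))
    (trans (cong (λ M → entry M i j) vwᵗ≡v′w′ᵗ) (entry-outer v′ w′ i j))
  same-w : lookup w ≗ lookup w′
  same-w j = trans (sym (gcdVec-column-outer v gcd≡1 w j))
    (trans (cong gcdVec (tabulate-cong λ i → same-entries i j)) (gcdVec-column-outer v′ gcd′≡1 w′ j))
  w≡w′ : w ≡ w′
  w≡w′ = lookup-extensionality w w′ same-w
  v≡v′ : v ≡ v′
  v≡v′ = lookup-extensionality v v′ λ i → *-cancelʳ-≡-pos _ _ w₀>0
    (trans (same-entries i zero) (cong (lookup v′ i *_) (sym (same-w zero))))

primitivePart : (Fin k → ℕ) → Fin k → ℕ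
primitivePart f i = _∣_.quotient (gcdVec-∣ f i)

primitivePart-* : (f : Fin k → ℕ) → ∀ i → primitivePart f i * gcdVec (tabulate f) ≡ f i
primitivePart-* f i = sym (_∣_.equality (gcdVec-∣ f i))

primitivePart-coprime : (f : Fin k → ℕ) → 0 < gcdVec (tabulate f) → gcdVec (tabulate (primitivePart f)) ≡ 1
primitivePart-coprime f g>0 = *-cancelˡ-≡-pos _ _ g>0 (begin
  g * gcdVec (tabulate (primitivePart f))
    ≡⟨ gcdVec-*ˡ g (primitivePart f) ⟨
  gcdVec (tabulate λ i → g * primitivePart f i)
    ≡⟨ cong gcdVec (tabulate-cong λ i → trans (*-comm g _) (primitivePart-* f i)) ⟩
  g
    ≡⟨ *-identityʳ g ⟨
  g * 1 ∎)
  where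
  open ≡-Reasoning
  g = gcdVec (tabulate f)

PrimitiveFactorisation : Matrix k → Set
PrimitiveFactorisation {k} A =
  ∃₂ λ (v w : Vec ℕ k) → All (0 <_) v × All (0 <_) w × gcdVec v ≡ 1 × outer v w ≡ A

rank-one-factorisation : (A : Matrix (suc k)) → (∀ i j → 0 < entry A i j) →
  (∀ i j → entry A i j * entry A zero zero ≡ entry A zero j * entry A i zero) →
  PrimitiveFactorisation A
rank-one-factorisation {k} A A>0 rank-one =
  tabulate v , tabulate w , tabulate⁺ v>0 , tabulate⁺ w>0 , primitivePart-coprime column₀ g>0 , vwᵗ≡A
  where
  open ≡-Reasoning
  a = entry A
  a₀₀ = a zero zero
  column₀ v w : Fin (suc k) → ℕ
  column₀ i = a i zero
  v = primitivePart column₀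
  w j = gcdVec (tabulate λ i → a i j)
  g : ℕ
  g = gcdVec (tabulate column₀)
  v>0 : ∀ i → 0 < v i
  v>0 i = m*n>0⇒m>0 (v i) g (subst (0 <_) (sym (primitivePart-* column₀ i)) (A>0 i zero))
  g>0 : 0 < g
  g>0 = m*n>0⇒n>0 (v zero) g (subst (0 <_) (sym (primitivePart-* column₀ zero)) (A>0 zero zero))
  a₀₀*w : ∀ j → a₀₀ * w j ≡ a zero j * g
  a₀₀*w j = begin
    a₀₀ * w j
      ≡⟨ gcdVec-*ˡ a₀₀ (λ i → a i j) ⟨
    gcdVec (tabulate λ i → a₀₀ * a i j)
      ≡⟨ cong gcdVec (tabulate-cong λ i → trans (*-comm a₀₀ (a i j)) (rank-one i j)) ⟩
    gcdVec (tabulate λ i → a zero j * column₀ i)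
      ≡⟨ gcdVec-*ˡ (a zero j) column₀ ⟩
    a zero j * g ∎
  a≡v*w : ∀ i j → a i j ≡ v i * w j
  a≡v*w i j = *-cancelˡ-≡-pos _ _ (A>0 zero zero) (begin
    a₀₀ * a i j          ≡⟨ *-comm a₀₀ (a i j) ⟩
    a i j * a₀₀          ≡⟨ rank-one i j ⟩
    a zero j * a i zero  ≡⟨ cong (a zero j *_) (primitivePart-* column₀ i) ⟨
    a zero j * (v i * g) ≡⟨ x∙yz≈y∙xz (a zero j) (v i) g ⟩
    v i * (a zero j * g) ≡⟨ cong (v i *_) (a₀₀*w j) ⟨
    v i * (a₀₀ * w j)    ≡⟨ x∙yz≈y∙xz (v i) a₀₀ (w j) ⟩
    a₀₀ * (v i * w j)    ∎)
  w>0 : ∀ j → 0 < w j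
  w>0 j = m*n>0⇒n>0 (v zero) (w j) (subst (0 <_) (a≡v*w zero j) (A>0 zero j))
  vwᵗ≡A : outer (tabulate v) (tabulate w) ≡ A
  vwᵗ≡A = entry-extensionality _ A λ i j → begin
    entry (outer (tabulate v) (tabulate w)) i j   ≡⟨ entry-outer (tabulate v) (tabulate w) i j ⟩
    lookup (tabulate v) i * lookup (tabulate w) j ≡⟨ cong₂ _*_ (lookup∘tabulate v i) (lookup∘tabulate w j) ⟩
    v i * w j                                     ≡⟨ a≡v*w i j ⟨
    a i j                                         ∎

outer-InK : {v w : Vec ℕ k} → InD n v w → InK n (outer v w)
outer-InK {n = n} {v} {w} ((v>0 , w>0 , v·w≡n) , _) = irreducible , square
  where
  irreducible : Irreducible (outer v w)
  irreducible i j = 0 , subst (0 <_) (sym (entry-outer v w i j)) (m*n>0 (lookup⁺ v>0 i) (lookup⁺ w>0 j))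
  square : outer v w ⊗ outer v w ≡ n · outer v w
  square = subst (λ s → outer v w ⊗ outer v w ≡ s · outer v w) v·w≡n (outer-⊗-outer v w)

InK⇒outer : {A : Matrix (suc k)} → InK n A → ∃₂ λ (v w : Vec ℕ (suc k)) → InD n v w × outer v w ≡ A
InK⇒outer {k} {n} {A} (irreducible , A²≡nA) = complete (rank-one-factorisation A A>0 rank-one)
  where
  A>0 : ∀ i j → 0 < entry A i j
  A>0 = irreducible⇒positive n A²≡nA irreducible
  rank-one : ∀ i j → entry A i j * entry A zero zero ≡ entry A zero j * entry A i zero
  rank-one i j = positive-eigenvectors-proportional (entry A) n (λ l → entry A l j) (λ l → entry A l zero)
    A>0 (λ l → A>0 l zero) (columns-eigenvectors n A²≡nA j) (columns-eigenvectors n A²≡nA zero) i zero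
  complete : PrimitiveFactorisation A → ∃₂ λ (v w : Vec ℕ (suc k)) → InD n v w × outer v w ≡ A
  complete (v , w , v>0 , w>0 , gcd≡1 , vwᵗ≡A) = v , w , ((v>0 , w>0 , v·w≡n) , gcd≡1) , vwᵗ≡A
    where
    v·w≡n : sum (zipWith _*_ v w) ≡ n
    v·w≡n = ·-cancelʳ A (A>0 zero zero)
      (trans (sym (subst (λ M → M ⊗ M ≡ sum (zipWith _*_ v w) · M) vwᵗ≡A (outer-⊗-outer v w))) A²≡nA)

lemma4p2 : (n : ℕ) → 1 ≤ n →
    (∀ (k : ℕ) (v w : Vec ℕ (suc k)) → InD n v w → InK n (outer v w))
    × (∀ (k : ℕ) (v w v′ w′ : Vec ℕ (suc k)) → InD n v w → InD n v′ w′ →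
    outer v w ≡ outer v′ w′ → v ≡ v′ × w ≡ w′)
    × (∀ (k : ℕ) (A : Matrix (suc k)) → InK n A →
    ∃₂ λ (v w : Vec ℕ (suc k)) → InD n v w × outer v w ≡ A)
lemma4p2 n _ =
    (λ k v w → outer-InK)
  , (λ k v w v′ w′ ((_ , w>0 , _) , gcd≡1) (_ , gcd′≡1) → outer-injective gcd≡1 gcd′≡1 (lookup⁺ w>0 zero))
  , (λ k A → InK⇒outer)
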